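{- Let $d,k,r$ be positive integers with $k\geq4$, $r\geq1$ and $d\geq 2k-3$. If $A$ is any set of vertices of $P_{d+r}\,\Box\,P_2$ with $|A\cap(\{1,\ldots,d\}\times\{1,2\})|\geq 2k-3$ and $|A\cap(\{d+1,\ldots,d+r\}\times\{1,2\})|\geq r+1$, then $A$ is not a $k$-general $d$-position set in $P_{d+r}\,\Box\,P_2$.
   Context: $P_m\,\Box\,P_2$ is the grid with vertex set $\{1,\ldots,m\}\times\{1,2\}$, where $(i,j)$ and $(i',j')$ are adjacent iff either $j=j'$ and $|i-i'|=1$, or $i=i'$ and $j\neq j'$. For a graph $G$, a geodesic is a shortest path between two vertices; its length $\lambda(g)$ is its number of edges. For $d\ge1$, $k\ge2$, $S\subseteq V(G)$ is a $k$-general $d$-position set if every geodesic $g$ with $|S\cap V(g)|\geq k$ has $\lambda(g)>d$. -}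

module Defs where

open import Data.Nat using (ℕ; zero; suc; _+_; _*_; _∸_; _≤_; _<_; _<ᵇ_)
open import Data.Fin using (Fin; toℕ)
open import Data.Bool using (Bool; true; false; not; _∧_; if_then_else_)
open import Data.List using (List; []; _∷_; length; filter; map; concatMap; allFin)
open import Data.List.Relation.Unary.Unique.Propositional using (Unique)
open import Data.Product using (_×_; _,_; proj₁)
open import Data.Sum using (_⊎_)
open import Relation.Binary.PropositionalEquality using (_≡_; _≢_)

-- Vertices of P_m □ P_2, 0-indexed: (i , j) with i : Fin m, j : Fin 2.
-- Paper vertex (i , j) corresponds to (i - 1 , j - 1) here.
Vertex : ℕ → Set
Vertex m = Fin m × Fin 2

Adj : {m : ℕ} → Vertex m → Vertex m → Set
Adj (i , j) (i' , j') =
  (j ≡ j' × (suc (toℕ i) ≡ toℕ i' ⊎ suc (toℕ i') ≡ toℕ i)) ⊎ (i ≡ i' × j ≢ j')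

IsWalk : {m : ℕ} → Vertex m → List (Vertex m) → Set
IsWalk u [] = Data.Unit.⊤ where import Data.Unit
IsWalk u (v ∷ vs) = Adj u v × IsWalk v vs

lastV : {m : ℕ} → Vertex m → List (Vertex m) → Vertex m
lastV u [] = u
lastV u (v ∷ vs) = lastV v vs

-- A path: a walk with pairwise distinct vertices. The path (u , vs) has
-- vertex list u ∷ vs, endpoints u and lastV u vs, and length (number of edges) length vs.
IsPath : {m : ℕ} → Vertex m → List (Vertex m) → Set
IsPath u vs = IsWalk u vs × Unique (u ∷ vs)

IsGeodesic : {m : ℕ} → Vertex m → List (Vertex m) → Set
IsGeodesic {m} u vs = IsPath u vs ×
  ((ws : List (Vertex m)) → IsPath u ws → lastV u ws ≡ lastV u vs → length vs ≤ length ws)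

countIn : {m : ℕ} → (Vertex m → Bool) → List (Vertex m) → ℕ
countIn S [] = 0
countIn S (v ∷ vs) = (if S v then 1 else 0) + countIn S vs

IsKGeneralDPosition : (m k d : ℕ) → (Vertex m → Bool) → Set
IsKGeneralDPosition m k d S =
  (u : Vertex m) (vs : List (Vertex m)) → IsGeodesic u vs →
  k ≤ countIn S (u ∷ vs) → d < length vs

allVertices : (m : ℕ) → List (Vertex m)
allVertices m = concatMap (λ i → map (λ j → (i , j)) (allFin 2)) (allFin m)

-- |A ∩ ({1..d} × {1,2})| : vertices with 0-indexed first coordinate < d
countLeft : {m : ℕ} → ℕ → (Vertex m → Bool) → ℕ
countLeft {m} d A = countIn (λ v → (toℕ (proj₁ v) <ᵇ d) ∧ A v) (allVertices m)

-- |A ∩ ({d+1..m} × {1,2})| : vertices with 0-indexed first coordinate ≥ d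
countRight : {m : ℕ} → ℕ → (Vertex m → Bool) → ℕ
countRight {m} d A = countIn (λ v → not (toℕ (proj₁ v) <ᵇ d) ∧ A v) (allVertices m)

module Submission where

-- Let x i ∈ {0,1,2} be the number of vertices of A in column i. A window of d consecutive
-- columns containing a full column (x = 2) carries two geodesics of length d, one starting in
-- each row at the left end of the window: follow that row up to the full column, cross it, and
-- follow the other row to the right end. Together they meet A in (weight of the window) + 2
-- vertices, so if the window has weight ≥ 2k − 3, one of them meets A in at least k vertices.
-- Such a window exists. Either the first d columns already contain a full column, or each of
-- them holds at most one vertex of A; in that case let c be least such that the c + 1 columns
-- following them hold more than c + 1 vertices (it exists because the last r columns hold
-- r + 1). Then the last of these c + 1 columns is full, and shifting the initial window right
-- by c + 1 columns loses at most c + 1 vertices on the left while gaining at least c + 2.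

open import Defs
open import Data.Nat using (ℕ; zero; suc; _+_; _*_; _∸_; _≤_; _<_; z≤n; s≤s; z<s; _<ᵇ_; ∣_-_∣)
open import Data.Nat.Properties
open import Data.Bool using (Bool; true; false; not; _∧_; if_then_else_)
open import Data.Bool.Properties using (T-≡; ¬-not)
open import Data.Empty using (⊥-elim)
open import Data.Fin using (Fin; toℕ; opposite) renaming (zero to fzero; suc to fsuc)
open import Data.List using (List; []; _∷_; _++_; length; map; concatMap; allFin; tabulate)
open import Data.List.Properties using (length-++; ++-identityʳ)
open import Data.List.Relation.Unary.Linked as Linked using (Linked; [-]; _∷_)
open import Data.List.Relation.Unary.Linked.Properties using (Linked⇒AllPairs)
import Data.List.Relation.Unary.AllPairs as AllPairs
open import Data.Product using (Σ-syntax; _×_; _,_; proj₁; proj₂)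
open import Data.Sum using (_⊎_; inj₁; inj₂; [_,_]′)
open import Data.Unit using (tt)
open import Function using (id; _∘_; _on_; Equivalence)
open import Relation.Binary.Construct.Intersection renaming (_∩_ to _∩ᵇ_)
open import Relation.Nullary using (¬_; yes; no; contradiction)
open import Relation.Unary using (Pred; Decidable)
open import Relation.Binary.PropositionalEquality
open import Algebra.Properties.CommutativeSemigroup +-commutativeSemigroup using (interchange; xy∙z≈xz∙y)

sumFrom : (ℕ → ℕ) → ℕ → ℕ → ℕ
sumFrom f p zero    = 0
sumFrom f p (suc n) = f p + sumFrom f (suc p) n

sumFrom-+ : ∀ f p m n → sumFrom f p (m + n) ≡ sumFrom f p m + sumFrom f (p + m) n
sumFrom-+ f p zero    n = cong (λ q → sumFrom f q n) (sym (+-identityʳ p))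
sumFrom-+ f p (suc m) n = begin
  f p + sumFrom f (suc p) (m + n)
    ≡⟨ cong (f p +_) (sumFrom-+ f (suc p) m n) ⟩
  f p + (sumFrom f (suc p) m + sumFrom f (suc p + m) n)
    ≡⟨ sym (+-assoc (f p) _ _) ⟩
  f p + sumFrom f (suc p) m + sumFrom f (suc p + m) n
    ≡⟨ cong (λ q → f p + sumFrom f (suc p) m + sumFrom f q n) (sym (+-suc p m)) ⟩
  f p + sumFrom f (suc p) m + sumFrom f (p + suc m) n ∎
  where open ≡-Reasoning

sumFrom-suc : ∀ f p n → sumFrom f p (suc n) ≡ sumFrom f p n + f (p + n)
sumFrom-suc f p n = begin
  sumFrom f p (suc n)             ≡⟨ cong (sumFrom f p) (+-comm 1 n) ⟩
  sumFrom f p (n + 1)             ≡⟨ sumFrom-+ f p n 1 ⟩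
  sumFrom f p n + (f (p + n) + 0) ≡⟨ cong (sumFrom f p n +_) (+-identityʳ _) ⟩
  sumFrom f p n + f (p + n)       ∎
  where open ≡-Reasoning

sumFrom-overlap : ∀ f p a n → sumFrom f p (suc a) + sumFrom f (p + a) n ≡ sumFrom f p (a + n) + f (p + a)
sumFrom-overlap f p a n = begin
  sumFrom f p (suc a) + sumFrom f (p + a) n           ≡⟨ cong (_+ sumFrom f (p + a) n) (sumFrom-suc f p a) ⟩
  sumFrom f p a + f (p + a) + sumFrom f (p + a) n     ≡⟨ xy∙z≈xz∙y (sumFrom f p a) _ _ ⟩
  sumFrom f p a + sumFrom f (p + a) n + f (p + a)     ≡⟨ cong (_+ f (p + a)) (sumFrom-+ f p a n) ⟨
  sumFrom f p (a + n) + f (p + a)                     ∎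
  where open ≡-Reasoning

sumFrom-distrib-+ : ∀ f g p n → sumFrom (λ i → f i + g i) p n ≡ sumFrom f p n + sumFrom g p n
sumFrom-distrib-+ f g p zero    = refl
sumFrom-distrib-+ f g p (suc n) =
  trans (cong (f p + g p +_) (sumFrom-distrib-+ f g (suc p) n))
        (interchange (f p) (g p) _ _)

sumFrom-cong : ∀ {f g} p n → (∀ i → p ≤ i → i < p + n → f i ≡ g i) →
               sumFrom f p n ≡ sumFrom g p n
sumFrom-cong p zero    f≗g = refl
sumFrom-cong p (suc n) f≗g = cong₂ _+_ (f≗g p ≤-refl (m<m+n p z<s))
  (sumFrom-cong (suc p) n λ i p<i i<p+n → f≗g i (<⇒≤ p<i) (subst (i <_) (sym (+-suc p n)) i<p+n))

sumFrom-0 : ∀ p n → sumFrom (λ _ → 0) p n ≡ 0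
sumFrom-0 p zero    = refl
sumFrom-0 p (suc n) = sumFrom-0 (suc p) n

sumFrom≤n : ∀ {f} p n → (∀ i → p ≤ i → i < p + n → f i ≤ 1) → sumFrom f p n ≤ n
sumFrom≤n p zero    f≤1 = z≤n
sumFrom≤n p (suc n) f≤1 = +-mono-≤ (f≤1 p ≤-refl (m<m+n p z<s))
  (sumFrom≤n (suc p) n λ i p<i i<p+n → f≤1 i (<⇒≤ p<i) (subst (i <_) (sym (+-suc p n)) i<p+n))

full-or-light : ∀ (x : ℕ → ℕ) n → (Σ[ i ∈ ℕ ] i < n × 2 ≤ x i) ⊎ (∀ i → i < n → x i ≤ 1)
full-or-light x zero = inj₂ λ i ()
full-or-light x (suc n) with full-or-light x n | 2 ≤? x n
... | inj₁ (i , i<n , 2≤xi) | _        = inj₁ (i , m<n⇒m<1+n i<n , 2≤xi)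
... | inj₂ light           | yes 2≤xn = inj₁ (n , ≤-refl , 2≤xn)
... | inj₂ light           | no  2≰xn = inj₂ λ i i<1+n →
  [ light i , (λ { refl → ≤-pred (≰⇒> 2≰xn) }) ]′ (m<1+n⇒m<n∨m≡n i<1+n)

module _ {ℓ} {P : Pred ℕ ℓ} (P? : Decidable P) (P0 : P 0) where

  all-or-firstFailure : ∀ n → (∀ q → q ≤ n → P q) ⊎
    (Σ[ c ∈ ℕ ] c < n × (∀ q → q ≤ c → P q) × ¬ P (suc c))
  all-or-firstFailure zero = inj₁ λ { q z≤n → P0 }
  all-or-firstFailure (suc n) with all-or-firstFailure n
  ... | inj₂ (c , c<n , P≤c , ¬Pc+1) = inj₂ (c , m<n⇒m<1+n c<n , P≤c , ¬Pc+1)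
  ... | inj₁ P≤n with P? (suc n)
  ...   | no  ¬Pn+1 = inj₂ (n , ≤-refl , P≤n , ¬Pn+1)
  ...   | yes Pn+1  = inj₁ λ q q≤1+n →
    [ (λ q<1+n → P≤n q (≤-pred q<1+n)) , (λ { refl → Pn+1 }) ]′ (m≤n⇒m<n∨m≡n q≤1+n)

record FullWindow (x : ℕ → ℕ) (T d m : ℕ) : Set where
  field
    first turn rest : ℕ
    width  : turn + suc rest ≡ d
    inside : first + d ≤ m
    full   : 2 ≤ x (first + turn)
    heavy  : T ≤ sumFrom x first d

lightPrefix : ∀ x d n → (∀ i → i < d → x i ≤ 1) → (∀ q → d + q ≤ n → sumFrom x d q ≤ q) →
              sumFrom x 0 n ≤ n
lightPrefix x d n light R≤ with n ≤? d
... | yes n≤d = sumFrom≤n 0 n λ i _ i<n → light i (<-≤-trans i<n n≤d)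
... | no  n≰d = subst (λ k → sumFrom x 0 k ≤ k) d+q≡n (begin
    sumFrom x 0 (d + q)           ≡⟨ sumFrom-+ x 0 d q ⟩
    sumFrom x 0 d + sumFrom x d q ≤⟨ +-mono-≤ (sumFrom≤n 0 d λ i _ → light i) (R≤ q (≤-reflexive d+q≡n)) ⟩
    d + q                         ∎)
  where
  open ≤-Reasoning
  q = n ∸ d
  d+q≡n : d + q ≡ n
  d+q≡n = m+[n∸m]≡n (<⇒≤ (≰⇒> n≰d))

fullWindow : ∀ x T d r → T ≤ sumFrom x 0 (suc d) → suc r ≤ sumFrom x (suc d) r →
             FullWindow x T (suc d) (suc d + r)
fullWindow x T d r T≤left r<right with full-or-light x (suc d)
... | inj₁ (i , i<1+d , full) = record
  { first = 0 ; turn = i ; rest = d ∸ i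
  ; width = trans (+-suc i _) (cong suc (m+[n∸m]≡n (≤-pred i<1+d)))
  ; inside = m≤m+n (suc d) r ; full = full ; heavy = T≤left }
... | inj₂ light with all-or-firstFailure (λ q → sumFrom x (suc d) q ≤? q) z≤n r
...   | inj₁ R≤ = contradiction (R≤ r ≤-refl) (<⇒≱ r<right)
...   | inj₂ (c , c<r , R≤ , R≰) = record
  { first = suc c ; turn = d ; rest = 0 ; width = +-comm d 1
  ; inside = subst (_≤ suc d + r) (+-comm (suc d) (suc c)) (+-monoʳ-≤ (suc d) c<r)
  ; full = subst (λ i → 2 ≤ x i) (cong suc (+-comm d c)) full
  ; heavy = heavy }
  where
  open ≤-Reasoning
  R = sumFrom x (suc d)
  W = sumFrom x (suc c) (suc d)
  full : 2 ≤ x (suc d + c)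
  full = +-cancelˡ-≤ c 2 _ (begin
    c + 2                 ≡⟨ +-comm c 2 ⟩
    suc (suc c)           ≤⟨ ≰⇒> R≰ ⟩
    R (suc c)             ≡⟨ sumFrom-suc x (suc d) c ⟩
    R c + x (suc d + c)   ≤⟨ +-monoˡ-≤ _ (R≤ c ≤-refl) ⟩
    c + x (suc d + c)     ∎)
  prefix : sumFrom x 0 (suc c) ≤ suc c
  prefix = lightPrefix x (suc d) (suc c) light
    λ q d+q<1+c → R≤ q (≤-trans (m≤n+m q d) (≤-pred d+q<1+c))
  heavy : T ≤ W
  heavy = +-cancelˡ-≤ (suc c) T W (begin
    suc c + T                            ≡⟨ +-comm (suc c) T ⟩
    T + suc c                            ≤⟨ +-mono-≤ T≤left (<⇒≤ (≰⇒> R≰)) ⟩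
    sumFrom x 0 (suc d) + R (suc c)      ≡⟨ sumFrom-+ x 0 (suc d) (suc c) ⟨
    sumFrom x 0 (suc d + suc c)          ≡⟨ cong (sumFrom x 0) (+-comm (suc d) (suc c)) ⟩
    sumFrom x 0 (suc c + suc d)          ≡⟨ sumFrom-+ x 0 (suc c) (suc d) ⟩
    sumFrom x 0 (suc c) + W              ≤⟨ +-monoˡ-≤ W prefix ⟩
    suc c + W                            ∎)

FullWindow-fits : ∀ {x T d m} (w : FullWindow x T d m) →
  let open FullWindow w in suc (first + turn + rest) ≤ m
FullWindow-fits {d = d} {m} w = begin
  suc (first + turn + rest)   ≡⟨ cong suc (+-assoc first turn rest) ⟩
  suc (first + (turn + rest)) ≡⟨ +-suc first (turn + rest) ⟨
  first + suc (turn + rest)   ≡⟨ cong (first +_) (trans (sym (+-suc turn rest)) width) ⟩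
  first + d                   ≤⟨ inside ⟩
  m                           ∎
  where
  open FullWindow w
  open ≤-Reasoning

-- Columns are addressed by ℕ; clamp saturates at the last column, so facts about clamp i
-- need i ≤ m.
clamp : ∀ {m} → ℕ → Fin (suc m)
clamp zero                = fzero
clamp {zero}  (suc i)     = fzero
clamp {suc m} (suc i)     = fsuc (clamp i)

toℕ-clamp : ∀ {m} i → i ≤ m → toℕ (clamp {m} i) ≡ i
toℕ-clamp zero    _         = refl
toℕ-clamp {suc m} (suc i) (s≤s i≤m) = cong suc (toℕ-clamp i i≤m)

clamp-toℕ : ∀ {m} (c : Fin (suc m)) → clamp (toℕ c) ≡ c
clamp-toℕ fzero            = refl
clamp-toℕ {suc m} (fsuc c) = cong fsuc (clamp-toℕ c)

lastV-++ : ∀ {m} (u : Vertex m) xs ys → lastV u (xs ++ ys) ≡ lastV (lastV u xs) ys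
lastV-++ u []       ys = refl
lastV-++ u (x ∷ xs) ys = lastV-++ x xs ys

countIn-++ : ∀ {m} (S : Vertex m → Bool) xs ys → countIn S (xs ++ ys) ≡ countIn S xs + countIn S ys
countIn-++ S []       ys = refl
countIn-++ S (x ∷ xs) ys =
  trans (cong (_ +_) (countIn-++ S xs ys)) (sym (+-assoc (if S x then 1 else 0) (countIn S xs) _))

dist : ∀ {m} → Vertex m → Vertex m → ℕ
dist (c , r) (c′ , r′) = ∣ toℕ c - toℕ c′ ∣ + ∣ toℕ r - toℕ r′ ∣

dist-triangle : ∀ {m} (u v w : Vertex m) → dist u w ≤ dist u v + dist v w
dist-triangle (c , r) (c′ , r′) (c″ , r″) = ≤-trans
  (+-mono-≤ (∣-∣-triangle (toℕ c) (toℕ c′) (toℕ c″)) (∣-∣-triangle (toℕ r) (toℕ r′) (toℕ r″)))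
  (≤-reflexive (interchange ∣ toℕ c - toℕ c′ ∣ ∣ toℕ c′ - toℕ c″ ∣ ∣ toℕ r - toℕ r′ ∣ ∣ toℕ r′ - toℕ r″ ∣))

∣n-1+n∣≡1 : ∀ n → ∣ n - suc n ∣ ≡ 1
∣n-1+n∣≡1 zero    = refl
∣n-1+n∣≡1 (suc n) = ∣n-1+n∣≡1 n

∣-∣-rows : (r r′ : Fin 2) → r ≢ r′ → ∣ toℕ r - toℕ r′ ∣ ≡ 1
∣-∣-rows fzero        fzero        r≢r′ = ⊥-elim (r≢r′ refl)
∣-∣-rows fzero        (fsuc fzero) _    = refl
∣-∣-rows (fsuc fzero) fzero        _    = refl
∣-∣-rows (fsuc fzero) (fsuc fzero) r≢r′ = ⊥-elim (r≢r′ refl)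

j≢opposite-j : (j : Fin 2) → j ≢ opposite j
j≢opposite-j fzero        ()
j≢opposite-j (fsuc fzero) ()

adj⇒dist≡1 : ∀ {m} (u v : Vertex m) → Adj u v → dist u v ≡ 1
adj⇒dist≡1 (c , r) (c′ , .r) (inj₁ (refl , inj₁ c+1≡c′)) rewrite sym c+1≡c′ | ∣n-n∣≡0 (toℕ r) =
  trans (+-identityʳ _) (∣n-1+n∣≡1 (toℕ c))
adj⇒dist≡1 (c , r) (c′ , .r) (inj₁ (refl , inj₂ c′+1≡c)) rewrite sym c′+1≡c | ∣n-n∣≡0 (toℕ r) =
  trans (+-identityʳ _) (trans (∣-∣-comm (suc (toℕ c′)) (toℕ c′)) (∣n-1+n∣≡1 (toℕ c′)))
adj⇒dist≡1 (c , r) (.c , r′) (inj₂ (refl , r≢r′)) rewrite ∣n-n∣≡0 (toℕ c) = ∣-∣-rows r r′ r≢r′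

dist≤walk-length : ∀ {m} (u : Vertex m) ws → IsWalk u ws → dist u (lastV u ws) ≤ length ws
dist≤walk-length (c , r) [] _ rewrite ∣n-n∣≡0 (toℕ c) | ∣n-n∣≡0 (toℕ r) = z≤n
dist≤walk-length u (v ∷ ws) (u~v , walk) = begin
  dist u (lastV v ws)                ≤⟨ dist-triangle u v (lastV v ws) ⟩
  dist u v + dist v (lastV v ws)     ≤⟨ +-mono-≤ (≤-reflexive (adj⇒dist≡1 u v u~v)) (dist≤walk-length v ws walk) ⟩
  suc (length ws)                    ∎
  where open ≤-Reasoning

path-of-length-dist⇒geodesic : ∀ {m} (u : Vertex m) vs → IsPath u vs →
  length vs ≤ dist u (lastV u vs) → IsGeodesic u vs
path-of-length-dist⇒geodesic u vs path short = path , λ ws (walk , _) same-end →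
  ≤-trans short (subst (λ v → dist u v ≤ length ws) same-end (dist≤walk-length u ws walk))

Step : ∀ {m} → (Vertex m → ℕ) → Vertex m → Vertex m → Set
Step key = Adj ∩ᵇ (_<_ on key)

linked⇒walk : ∀ {m} {u : Vertex m} {vs} → Linked Adj (u ∷ vs) → IsWalk u vs
linked⇒walk [-]            = tt
linked⇒walk (u~v ∷ linked) = u~v , linked⇒walk linked

linked⇒path : ∀ {m} (key : Vertex m → ℕ) {u : Vertex m} {vs} → Linked (Step key) (u ∷ vs) → IsPath u vs
linked⇒path key linked = linked⇒walk adjacent ,
  AllPairs.map (λ lt eq → <-irrefl (cong key eq) lt) (Linked⇒AllPairs <-trans increasing)
  where
  adjacent = proj₁ (Linked.unzip linked)
  increasing = proj₂ (Linked.unzip linked)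

module _ {m : ℕ} where

  -- Along an L-path starting in row j, the distance from the corner (0 , j) grows at every
  -- step; through linked⇒path this makes the vertices of the path distinct.
  cornerDist : Fin 2 → Vertex (suc m) → ℕ
  cornerDist j = dist (fzero , j)

  columnStep : ∀ j₀ j {c c′ : Fin (suc m)} → toℕ c′ ≡ suc (toℕ c) →
               Step (cornerDist j₀) (c , j) (c′ , j)
  columnStep j₀ j c′≡c+1 = inj₁ (refl , inj₁ (sym c′≡c+1)) , subst (λ n → _ < n + _) (sym c′≡c+1) ≤-refl

  rowSwitch : ∀ (c : Fin (suc m)) j → Step (cornerDist j) (c , j) (c , opposite j)
  rowSwitch c fzero        = inj₂ (refl , j≢opposite-j fzero) , +-monoʳ-< (toℕ c) z<s
  rowSwitch c (fsuc fzero) = inj₂ (refl , j≢opposite-j (fsuc fzero)) , +-monoʳ-< (toℕ c) z<s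

  row : Fin 2 → ℕ → ℕ → List (Vertex (suc m))
  row j p zero    = []
  row j p (suc n) = (clamp p , j) ∷ row j (suc p) n

  row-++-linked : ∀ j₀ j p n ys → p + n ≤ m → Linked (Step (cornerDist j₀)) ((clamp (p + n) , j) ∷ ys) →
                  Linked (Step (cornerDist j₀)) (row j p (suc n) ++ ys)
  row-++-linked j₀ j p zero    ys _ linked rewrite +-identityʳ p = linked
  row-++-linked j₀ j p (suc n) ys p+n+1≤m linked =
    columnStep j₀ j c′≡c+1 ∷ row-++-linked j₀ j (suc p) n ys p+1+n≤m
      (subst (λ q → Linked (Step (cornerDist j₀)) ((clamp q , j) ∷ ys)) (+-suc p n) linked)
    where
    p+1+n≤m = subst (_≤ m) (+-suc p n) p+n+1≤m
    c′≡c+1 : toℕ (clamp {m} (suc p)) ≡ suc (toℕ (clamp {m} p))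
    c′≡c+1 = trans (toℕ-clamp (suc p) (≤-trans (m≤m+n (suc p) n) p+1+n≤m))
                   (cong suc (sym (toℕ-clamp p (≤-trans (m≤m+n p (suc n)) p+n+1≤m))))

  row-linked : ∀ j₀ j p n → p + n ≤ m → Linked (Step (cornerDist j₀)) ((clamp p , j) ∷ row j (suc p) n)
  row-linked j₀ j p n p+n≤m = subst (Linked _) (++-identityʳ _) (row-++-linked j₀ j p n [] p+n≤m [-])

  row-last : ∀ j p n → lastV (clamp p , j) (row j (suc p) n) ≡ (clamp (p + n) , j)
  row-last j p zero    = cong (λ q → clamp q , j) (sym (+-identityʳ p))
  row-last j p (suc n) = trans (row-last j (suc p) n) (cong (λ q → clamp q , j) (sym (+-suc p n)))

  row-length : ∀ j p n → length (row j p n) ≡ n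
  row-length j p zero    = refl
  row-length j p (suc n) = cong suc (row-length j (suc p) n)

  lPath : Fin 2 → ℕ → ℕ → ℕ → List (Vertex (suc m))
  lPath j s a b = row j (suc s) a ++ row (opposite j) (s + a) (suc b)

  lPath-length : ∀ j s a b → length (lPath j s a b) ≡ a + suc b
  lPath-length j s a b = trans (length-++ (row j (suc s) a))
    (cong₂ _+_ (row-length j (suc s) a) (row-length (opposite j) (s + a) (suc b)))

  lPath-last : ∀ j s a b → lastV (clamp s , j) (lPath j s a b) ≡ (clamp (s + a + b) , opposite j)
  lPath-last j s a b = begin
    lastV (clamp s , j) (lPath j s a b)
      ≡⟨ lastV-++ (clamp s , j) (row j (suc s) a) _ ⟩
    lastV (lastV (clamp s , j) (row j (suc s) a)) (row (opposite j) (s + a) (suc b))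
      ≡⟨ cong (λ u → lastV u (row (opposite j) (s + a) (suc b))) (row-last j s a) ⟩
    lastV (clamp (s + a) , opposite j) (row (opposite j) (suc (s + a)) b)
      ≡⟨ row-last (opposite j) (s + a) b ⟩
    (clamp (s + a + b) , opposite j) ∎
    where open ≡-Reasoning

  lPath-dist : ∀ j s a b → s + a + b ≤ m → dist (clamp s , j) (clamp (s + a + b) , opposite j) ≡ a + suc b
  lPath-dist j s a b s+a+b≤m = begin
    ∣ toℕ (clamp {m} s) - toℕ (clamp {m} (s + a + b)) ∣ + ∣ toℕ j - toℕ (opposite j) ∣
      ≡⟨ cong₂ (λ c c′ → ∣ c - c′ ∣ + _) (toℕ-clamp s s≤m) (toℕ-clamp (s + a + b) s+a+b≤m) ⟩
    ∣ s - s + a + b ∣ + ∣ toℕ j - toℕ (opposite j) ∣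
      ≡⟨ cong₂ _+_ (trans (cong (∣ s -_∣) (+-assoc s a b)) (∣m-m+n∣≡n s (a + b)))
                   (∣-∣-rows j (opposite j) (j≢opposite-j j)) ⟩
    a + b + 1
      ≡⟨ +-assoc a b 1 ⟩
    a + (b + 1)
      ≡⟨ cong (a +_) (+-comm b 1) ⟩
    a + suc b ∎
    where
    open ≡-Reasoning
    s≤m = ≤-trans (≤-trans (m≤m+n s a) (m≤m+n (s + a) b)) s+a+b≤m

  lPath-linked : ∀ j s a b → s + a + b ≤ m → Linked (Step (cornerDist j)) ((clamp s , j) ∷ lPath j s a b)
  lPath-linked j s a b s+a+b≤m = row-++-linked j j s a _ (≤-trans (m≤m+n (s + a) b) s+a+b≤m)
    (rowSwitch (clamp (s + a)) j ∷ row-linked j (opposite j) (s + a) b s+a+b≤m)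

  lPath-geodesic : ∀ j s a b → s + a + b ≤ m → IsGeodesic (clamp s , j) (lPath j s a b)
  lPath-geodesic j s a b s+a+b≤m =
    path-of-length-dist⇒geodesic _ _ (linked⇒path (cornerDist j) (lPath-linked j s a b s+a+b≤m)) (≤-reflexive (begin
      length (lPath j s a b)                                  ≡⟨ lPath-length j s a b ⟩
      a + suc b                                               ≡⟨ lPath-dist j s a b s+a+b≤m ⟨
      dist (clamp s , j) (clamp (s + a + b) , opposite j)     ≡⟨ cong (dist (clamp s , j)) (lPath-last j s a b) ⟨
      dist (clamp s , j) (lastV (clamp s , j) (lPath j s a b)) ∎))
    where open ≡-Reasoning

module _ {m : ℕ} (S : Vertex (suc m) → Bool) where

  indicator : Fin 2 → ℕ → ℕ
  indicator j i = if S (clamp i , j) then 1 else 0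

  columnWeight : ℕ → ℕ
  columnWeight i = indicator fzero i + indicator (fsuc fzero) i

  countIn-row : ∀ j p n → countIn S (row j p n) ≡ sumFrom (indicator j) p n
  countIn-row j p zero    = refl
  countIn-row j p (suc n) = cong (indicator j p +_) (countIn-row j (suc p) n)

  lPath-count : ∀ j s a b → countIn S ((clamp s , j) ∷ lPath j s a b) ≡
                sumFrom (indicator j) s (suc a) + sumFrom (indicator (opposite j)) (s + a) (suc b)
  lPath-count j s a b = trans (countIn-++ S (row j s (suc a)) _)
    (cong₂ _+_ (countIn-row j s (suc a)) (countIn-row (opposite j) (s + a) (suc b)))

  lPaths-count : ∀ s a b →
    countIn S ((clamp s , fzero) ∷ lPath fzero s a b) + countIn S ((clamp s , fsuc fzero) ∷ lPath (fsuc fzero) s a b)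
      ≡ sumFrom columnWeight s (a + suc b) + columnWeight (s + a)
  lPaths-count s a b = begin
    countIn S ((clamp s , fzero) ∷ lPath fzero s a b) + countIn S ((clamp s , fsuc fzero) ∷ lPath (fsuc fzero) s a b)
      ≡⟨ cong₂ _+_ (lPath-count fzero s a b) (lPath-count (fsuc fzero) s a b) ⟩
    (I₀ s (suc a) + I₁ (s + a) (suc b)) + (I₁ s (suc a) + I₀ (s + a) (suc b))
      ≡⟨ interchange (I₀ s (suc a)) _ _ _ ⟩
    (I₀ s (suc a) + I₁ s (suc a)) + (I₁ (s + a) (suc b) + I₀ (s + a) (suc b))
      ≡⟨ cong₂ _+_ (sumFrom-distrib-+ (indicator fzero) (indicator (fsuc fzero)) s (suc a))
                     (trans (sumFrom-distrib-+ (indicator fzero) (indicator (fsuc fzero)) (s + a) (suc b)) (+-comm (I₀ (s + a) (suc b)) _)) ⟨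
    sumFrom columnWeight s (suc a) + sumFrom columnWeight (s + a) (suc b)
      ≡⟨ sumFrom-overlap columnWeight s a (suc b) ⟩
    sumFrom columnWeight s (a + suc b) + columnWeight (s + a) ∎
    where
    open ≡-Reasoning
    I₀ = sumFrom (indicator fzero)
    I₁ = sumFrom (indicator (fsuc fzero))

<⇒<ᵇ≡true : ∀ {i d} → i < d → (i <ᵇ d) ≡ true
<⇒<ᵇ≡true i<d = Equivalence.to T-≡ (<⇒<ᵇ i<d)

≤⇒<ᵇ≡false : ∀ {i d} → d ≤ i → (i <ᵇ d) ≡ false
≤⇒<ᵇ≡false {i} {d} d≤i = ¬-not λ i<ᵇd → ≤⇒≯ d≤i (<ᵇ⇒< i d (Equivalence.from T-≡ i<ᵇd))

module _ {m : ℕ} where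

  columns : List (Fin (suc m)) → List (Vertex (suc m))
  columns = concatMap (λ i → map (λ j → (i , j)) (allFin 2))

  countIn-columns : ∀ (S : Vertex (suc m) → Bool) n p (g : Fin n → Fin (suc m)) →
    (∀ i → g i ≡ clamp (p + toℕ i)) → countIn S (columns (tabulate g)) ≡ sumFrom (columnWeight S) p n
  countIn-columns S zero    p g g≡ = refl
  countIn-columns S (suc n) p g g≡ = begin
    countIn S (columns (tabulate g))
      ≡⟨ countIn-++ S (map (λ j → (g fzero , j)) (allFin 2)) (columns (tabulate (g ∘ fsuc))) ⟩
    countIn S (map (λ j → (g fzero , j)) (allFin 2)) + countIn S (columns (tabulate (g ∘ fsuc)))
      ≡⟨ cong₂ _+_ (first-column (g≡ fzero)) (countIn-columns S n (suc p) (g ∘ fsuc) g∘suc≡) ⟩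
    columnWeight S p + sumFrom (columnWeight S) (suc p) n ∎
    where
    open ≡-Reasoning
    first-column : ∀ {c} → c ≡ clamp (p + 0) → countIn S (map (λ j → (c , j)) (allFin 2)) ≡ columnWeight S p
    first-column refl rewrite +-identityʳ p = cong (indicator S fzero p +_) (+-identityʳ _)
    g∘suc≡ : ∀ i → g (fsuc i) ≡ clamp (suc p + toℕ i)
    g∘suc≡ i = trans (g≡ (fsuc i)) (cong clamp (+-suc p (toℕ i)))

  countIn-allVertices : ∀ (S : Vertex (suc m) → Bool) →
    countIn S (allVertices (suc m)) ≡ sumFrom (columnWeight S) 0 (suc m)
  countIn-allVertices S = countIn-columns S (suc m) 0 id (λ i → sym (clamp-toℕ i))

  module _ (A : Vertex (suc m) → Bool) where

    countIn-columnFilter : ∀ (b : ℕ → Bool) →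
      countIn (λ v → b (toℕ (proj₁ v)) ∧ A v) (allVertices (suc m)) ≡
      sumFrom (λ i → if b i then columnWeight A i else 0) 0 (suc m)
    countIn-columnFilter b = trans (countIn-allVertices (λ v → b (toℕ (proj₁ v)) ∧ A v))
      (sumFrom-cong 0 (suc m) λ i _ i<1+m → filtered i (toℕ-clamp i (≤-pred i<1+m)))
      where
      filtered : ∀ i → toℕ (clamp {m} i) ≡ i →
        columnWeight (λ v → b (toℕ (proj₁ v)) ∧ A v) i ≡ (if b i then columnWeight A i else 0)
      filtered i c≡i rewrite c≡i with b i
      ... | true  = refl
      ... | false = refl

    module _ (d r : ℕ) (d+r≡1+m : d + r ≡ suc m) where

      countLeft≡sumFrom : countLeft d A ≡ sumFrom (columnWeight A) 0 d
      countLeft≡sumFrom = begin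
        countLeft d A                           ≡⟨ countIn-columnFilter (_<ᵇ d) ⟩
        sumFrom weight 0 (suc m)                ≡⟨ cong (sumFrom weight 0) d+r≡1+m ⟨
        sumFrom weight 0 (d + r)                ≡⟨ sumFrom-+ weight 0 d r ⟩
        sumFrom weight 0 d + sumFrom weight d r ≡⟨ cong₂ _+_ on-left on-right ⟩
        sumFrom (columnWeight A) 0 d + 0        ≡⟨ +-identityʳ _ ⟩
        sumFrom (columnWeight A) 0 d            ∎
        where
        open ≡-Reasoning
        weight = λ i → if i <ᵇ d then columnWeight A i else 0
        on-left : sumFrom weight 0 d ≡ sumFrom (columnWeight A) 0 d
        on-left = sumFrom-cong 0 d λ i _ i<d → cong (if_then columnWeight A i else 0) (<⇒<ᵇ≡true i<d)
        on-right : sumFrom weight d r ≡ 0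
        on-right = trans (sumFrom-cong d r λ i d≤i _ → cong (if_then columnWeight A i else 0) (≤⇒<ᵇ≡false d≤i))
                         (sumFrom-0 d r)

      countRight≡sumFrom : countRight d A ≡ sumFrom (columnWeight A) d r
      countRight≡sumFrom = begin
        countRight d A                          ≡⟨ countIn-columnFilter (λ i → not (i <ᵇ d)) ⟩
        sumFrom weight 0 (suc m)                ≡⟨ cong (sumFrom weight 0) d+r≡1+m ⟨
        sumFrom weight 0 (d + r)                ≡⟨ sumFrom-+ weight 0 d r ⟩
        sumFrom weight 0 d + sumFrom weight d r ≡⟨ cong₂ _+_ on-left on-right ⟩
        0 + sumFrom (columnWeight A) d r        ∎
        where
        open ≡-Reasoning
        weight = λ i → if not (i <ᵇ d) then columnWeight A i else 0
        on-left : sumFrom weight 0 d ≡ 0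
        on-left = trans (sumFrom-cong 0 d λ i _ i<d → cong (λ b → if not b then columnWeight A i else 0) (<⇒<ᵇ≡true i<d))
                        (sumFrom-0 0 d)
        on-right : sumFrom weight d r ≡ sumFrom (columnWeight A) d r
        on-right = sumFrom-cong d r λ i d≤i _ → cong (λ b → if not b then columnWeight A i else 0) (≤⇒<ᵇ≡false d≤i)

kGeneral-short-geodesic : ∀ {m k d S} {u : Vertex m} {vs} → IsKGeneralDPosition m k d S →
  IsGeodesic u vs → length vs ≤ d → countIn S (u ∷ vs) < k
kGeneral-short-geodesic {u = u} {vs} kgp geodesic short = ≰⇒> λ k≤count → ≤⇒≯ short (kgp u vs geodesic k≤count)

p,q<k⇒p+q<2k∸3+2 : ∀ k p q → 2 ≤ k → p < k → q < k → p + q < 2 * k ∸ 3 + 2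
p,q<k⇒p+q<2k∸3+2 k p q 2≤k p<k q<k = +-cancelʳ-< 2 (p + q) (2 * k ∸ 3 + 2) (begin-strict
  p + q + 2            ≡⟨ +-comm (p + q) 2 ⟩
  suc (suc (p + q))    ≡⟨ cong suc (+-suc p q) ⟨
  suc p + suc q        ≤⟨ +-mono-≤ p<k (≤-trans q<k (≤-reflexive (sym (+-identityʳ k)))) ⟩
  2 * k                ≡⟨ m∸n+n≡m 3≤2k ⟨
  2 * k ∸ 3 + 3        <⟨ +-monoʳ-< (2 * k ∸ 3) (n<1+n 3) ⟩
  2 * k ∸ 3 + (2 + 2)  ≡⟨ +-assoc (2 * k ∸ 3) 2 2 ⟨
  2 * k ∸ 3 + 2 + 2    ∎)
  where
  open ≤-Reasoning
  3≤2k : 3 ≤ 2 * k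
  3≤2k = ≤-trans (s≤s (s≤s (s≤s z≤n))) (*-monoʳ-≤ 2 2≤k)

lemma6p6 : (d k r : ℕ) → 1 ≤ d → 4 ≤ k → 1 ≤ r → 2 * k ∸ 3 ≤ d →
    (A : Vertex (d + r) → Bool) →
    2 * k ∸ 3 ≤ countLeft d A →
    r + 1 ≤ countRight d A →
    ¬ IsKGeneralDPosition (d + r) k d A
lemma6p6 (suc d) k r _ 4≤k _ _ A T≤left r+1≤right kgp = <⇒≱
  (p,q<k⇒p+q<2k∸3+2 k (lCount fzero) (lCount (fsuc fzero)) (≤-trans (s≤s (s≤s z≤n)) 4≤k)
    (lCount<k fzero) (lCount<k (fsuc fzero)))
  (subst (2 * k ∸ 3 + 2 ≤_) (sym lCounts) (+-mono-≤ heavy full))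
  where
  x = columnWeight A
  window : FullWindow x (2 * k ∸ 3) (suc d) (suc d + r)
  window = fullWindow x (2 * k ∸ 3) d r
    (subst (2 * k ∸ 3 ≤_) (countLeft≡sumFrom A (suc d) r refl) T≤left)
    (subst₂ _≤_ (+-comm r 1) (countRight≡sumFrom A (suc d) r refl) r+1≤right)
  open FullWindow window
  lCount : Fin 2 → ℕ
  lCount j = countIn A ((clamp first , j) ∷ lPath j first turn rest)
  lCount<k : ∀ j → lCount j < k
  lCount<k j = kGeneral-short-geodesic kgp (lPath-geodesic j first turn rest (≤-pred (FullWindow-fits window)))
    (≤-reflexive (trans (lPath-length j first turn rest) width))
  lCounts : lCount fzero + lCount (fsuc fzero) ≡ sumFrom x first (suc d) + x (first + turn)
  lCounts = trans (lPaths-count A first turn rest) (cong (λ n → sumFrom x first n + x (first + turn)) width)
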